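{- $c(K_3,C_5)\le 3/34$.
   Context: $K_3$ is the triangle and $C_5$ the cycle of length 5. For graphs $H,G$, $t(H,G)$ is the probability that a uniformly random map $V(H)\to V(G)$ is a homomorphism. Let $G_1,G_2,\dots$ be a sequence containing every finite graph exactly once; $\overline{G}$ is the complement. For $\lambda\in[0,2]$, $c_\lambda(H_1,H_2):=\liminf_{n\to\infty}[\lambda\, t(H_1,G_n)+(2-\lambda)\, t(H_2,\overline{G_n})]$ and $c(H_1,H_2):=\sup_{\lambda\in[0,2]}c_\lambda(H_1,H_2)$.
   Formalization: The parameter λ in the supremum defining $c(H_1,H_2)$ ranges only over the rationals in [0,2]. -}

module Defs where

open import Data.Nat using (ℕ; zero; suc; _^_)
open import Data.Fin using (Fin; zero; suc; _≟_)
open import Data.Bool using (Bool; true; false; not; _∨_; if_then_else_)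
open import Data.List using (List; []; _∷_; map; concatMap; length; allFin; filterᵇ)
open import Data.Bool.ListAction using (all)
open import Data.Nat.Properties using (m^n≢0)
open import Data.Vec using (Vec; []; _∷_; lookup)
open import Data.Integer using (+_)
open import Data.Rational using (ℚ; _/_)
open import Data.Empty using (⊥-elim)
open import Relation.Nullary using (yes; no)
open import Relation.Binary.PropositionalEquality using (_≡_; refl; sym)

record Graph (n : ℕ) : Set where
  field
    adj    : Fin n → Fin n → Bool
    adj-sym    : ∀ i j → adj i j ≡ adj j i
    adj-irrefl : ∀ i → adj i i ≡ false
open Graph public

complAdj : ∀ {n} → Graph n → Fin n → Fin n → Bool
complAdj G i j with i ≟ j
... | yes _ = false
... | no _  = not (adj G i j)

complement : ∀ {n} → Graph n → Graph n
complement {n} G = record { adj = complAdj G ; adj-sym = s ; adj-irrefl = r }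
  where
  s : ∀ i j → complAdj G i j ≡ complAdj G j i
  s i j with i ≟ j | j ≟ i
  ... | yes _ | yes _ = refl
  ... | yes p | no q = ⊥-elim (q (sym p))
  ... | no q | yes p = ⊥-elim (q (sym p))
  ... | no _ | no _ rewrite adj-sym G i j = refl
  r : ∀ i → complAdj G i i ≡ false
  r i with i ≟ i
  ... | yes _ = refl
  ... | no q = ⊥-elim (q refl)

allMaps : (h n : ℕ) → List (Vec (Fin n) h)
allMaps zero n = [] ∷ []
allMaps (suc h) n = concatMap (λ v → map (_∷ v) (allFin n)) (allMaps h n)

isHom : ∀ {h n} → Graph h → Graph n → Vec (Fin n) h → Bool
isHom {h} H G v =
  all (λ i → all (λ j → not (adj H i j) ∨ adj G (lookup v i) (lookup v j)) (allFin h)) (allFin h)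

hom : ∀ {h n} → Graph h → Graph n → ℕ
hom {h} {n} H G = length (filterᵇ (isHom H G) (allMaps h n))

t : ∀ {h m} → Graph h → Graph (suc m) → ℚ
t {h} {m} H G = _/_ (+ hom H G) (suc m ^ h) {{m^n≢0 (suc m) h}}

K3adj : Fin 3 → Fin 3 → Bool
K3adj i j with i ≟ j
... | yes _ = false
... | no _ = true

K3 : Graph 3
K3 = record { adj = K3adj ; adj-sym = s ; adj-irrefl = r }
  where
  s : ∀ i j → K3adj i j ≡ K3adj j i
  s i j with i ≟ j | j ≟ i
  ... | yes _ | yes _ = refl
  ... | yes p | no q = ⊥-elim (q (sym p))
  ... | no q | yes p = ⊥-elim (q (sym p))
  ... | no _ | no _ = refl
  r : ∀ i → K3adj i i ≡ false
  r i with i ≟ i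
  ... | yes _ = refl
  ... | no q = ⊥-elim (q refl)

C5adj : Fin 5 → Fin 5 → Bool
C5adj zero (suc zero) = true
C5adj (suc zero) zero = true
C5adj (suc zero) (suc (suc zero)) = true
C5adj (suc (suc zero)) (suc zero) = true
C5adj (suc (suc zero)) (suc (suc (suc zero))) = true
C5adj (suc (suc (suc zero))) (suc (suc zero)) = true
C5adj (suc (suc (suc zero))) (suc (suc (suc (suc zero)))) = true
C5adj (suc (suc (suc (suc zero)))) (suc (suc (suc zero))) = true
C5adj (suc (suc (suc (suc zero)))) zero = true
C5adj zero (suc (suc (suc (suc zero)))) = true
C5adj _ _ = false

C5 : Graph 5
C5 = record { adj = C5adj ; adj-sym = s ; adj-irrefl = r }
  where
  F = Fin 5
  s : ∀ i j → C5adj i j ≡ C5adj j i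
  s zero zero = refl
  s zero (suc zero) = refl
  s zero (suc (suc zero)) = refl
  s zero (suc (suc (suc zero))) = refl
  s zero (suc (suc (suc (suc zero)))) = refl
  s (suc zero) zero = refl
  s (suc zero) (suc zero) = refl
  s (suc zero) (suc (suc zero)) = refl
  s (suc zero) (suc (suc (suc zero))) = refl
  s (suc zero) (suc (suc (suc (suc zero)))) = refl
  s (suc (suc zero)) zero = refl
  s (suc (suc zero)) (suc zero) = refl
  s (suc (suc zero)) (suc (suc zero)) = refl
  s (suc (suc zero)) (suc (suc (suc zero))) = refl
  s (suc (suc zero)) (suc (suc (suc (suc zero)))) = refl
  s (suc (suc (suc zero))) zero = refl
  s (suc (suc (suc zero))) (suc zero) = refl
  s (suc (suc (suc zero))) (suc (suc zero)) = refl
  s (suc (suc (suc zero))) (suc (suc (suc zero))) = refl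
  s (suc (suc (suc zero))) (suc (suc (suc (suc zero)))) = refl
  s (suc (suc (suc (suc zero)))) zero = refl
  s (suc (suc (suc (suc zero)))) (suc zero) = refl
  s (suc (suc (suc (suc zero)))) (suc (suc zero)) = refl
  s (suc (suc (suc (suc zero)))) (suc (suc (suc zero))) = refl
  s (suc (suc (suc (suc zero)))) (suc (suc (suc (suc zero)))) = refl
  r : ∀ i → C5adj i i ≡ false
  r zero = refl
  r (suc zero) = refl
  r (suc (suc zero)) = refl
  r (suc (suc (suc zero))) = refl
  r (suc (suc (suc (suc zero)))) = refl

{-# OPTIONS --safe #-}
module Submission where

-- For λ ≤ 10/17 take balanced blow-ups of the triangular prism (the complement of C₆), for
-- λ ≥ 10/17 balanced blow-ups of K₂, i.e. complete bipartite graphs. Blowing B up by a factor n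
-- multiplies homomorphism counts from H by n^|H|, so densities are those of B; and the complement
-- of a blow-up of B lies inside the blow-up of the complement of B with a loop at every vertex.
-- Counting in the 6- and 2-vertex graphs gives t(K₃) = 12/6³, t(C₅, complement) ≤ 306/6⁵ for
-- the prism and t(K₃) = 0, t(C₅, complement) ≤ 2/2⁵ for K₂. Both bounds are affine in λ and
-- equal 3/34 at λ = 10/17.

open import Defs

module Sums where
  open import Data.Fin using (Fin; zero; suc; quotient; _↑ˡ_; _↑ʳ_)
  open import Data.Fin.Properties using (splitAt-↑ˡ; splitAt-↑ʳ)
  open import Data.List using (List; []; _∷_; _++_; map; concatMap; tabulate; allFin)
  open import Data.List.Properties using (map-++; map-∘)
  open import Data.Nat using (ℕ; zero; suc; _+_; _*_; _^_; _≤_; z≤n)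
  open import Data.Nat.ListAction using (sum)
  open import Data.Nat.ListAction.Properties using (sum-++)
  open import Data.Nat.Properties
    using (+-0-monoid; +-assoc; +-identityʳ; *-zeroʳ; *-assoc; *-comm; *-distribˡ-+; +-mono-≤)
  open import Data.Vec using (Vec; []; _∷_) renaming (map to vmap)
  open import Function using (id; _∘_)
  open import Relation.Binary.PropositionalEquality using (_≡_; refl; sym; trans; cong; cong₂; module ≡-Reasoning)

  open import Algebra.Properties.Monoid.Sum +-0-monoid using (sum-syntax; sum-cong-≗)

  ∑ : {A : Set} → List A → (A → ℕ) → ℕ
  ∑ xs f = sum (map f xs)

  infixl 10 ∑
  syntax ∑ xs (λ x → e) = ∑[ x ∈ xs ] e

  ∑-cong : {A : Set} {f g : A → ℕ} → (∀ x → f x ≡ g x) → ∀ xs → ∑ xs f ≡ ∑ xs g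
  ∑-cong e []       = refl
  ∑-cong e (x ∷ xs) = cong₂ _+_ (e x) (∑-cong e xs)

  ∑-mono : {A : Set} {f g : A → ℕ} → (∀ x → f x ≤ g x) → ∀ xs → ∑ xs f ≤ ∑ xs g
  ∑-mono e []       = z≤n
  ∑-mono e (x ∷ xs) = +-mono-≤ (e x) (∑-mono e xs)

  ∑-*ˡ : {A : Set} (n : ℕ) (f : A → ℕ) → ∀ xs → ∑[ x ∈ xs ] (n * f x) ≡ n * ∑ xs f
  ∑-*ˡ n f []       = sym (*-zeroʳ n)
  ∑-*ˡ n f (x ∷ xs) = trans (cong (n * f x +_) (∑-*ˡ n f xs)) (sym (*-distribˡ-+ n (f x) _))

  ∑-++ : {A : Set} (xs ys : List A) (f : A → ℕ) → ∑ (xs ++ ys) f ≡ ∑ xs f + ∑ ys f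
  ∑-++ xs ys f = trans (cong sum (map-++ f xs ys)) (sum-++ (map f xs) (map f ys))

  ∑-concatMap : {A B : Set} (F : A → List B) (f : B → ℕ) →
                ∀ xs → ∑ (concatMap F xs) f ≡ ∑[ x ∈ xs ] ∑ (F x) f
  ∑-concatMap F f []       = refl
  ∑-concatMap F f (x ∷ xs) = trans (∑-++ (F x) (concatMap F xs) f) (cong (∑ (F x) f +_) (∑-concatMap F f xs))

  ∑-map : {A B : Set} (F : A → B) (f : B → ℕ) → ∀ xs → ∑ (map F xs) f ≡ ∑[ x ∈ xs ] f (F x)
  ∑-map F f xs = cong sum (sym (map-∘ xs))

  ∑-tabulate : {A : Set} {n : ℕ} (g : Fin n → A) (f : A → ℕ) → ∑ (tabulate g) f ≡ ∑[ i < n ] f (g i)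
  ∑-tabulate {n = zero}  g f = refl
  ∑-tabulate {n = suc n} g f = cong (f (g zero) +_) (∑-tabulate (g ∘ suc) f)

  ∑-allFin : (n : ℕ) (f : Fin n → ℕ) → ∑ (allFin n) f ≡ ∑[ i < n ] f i
  ∑-allFin n = ∑-tabulate id

  ∑-const : (n c : ℕ) → ∑[ i < n ] c ≡ n * c
  ∑-const zero    c = refl
  ∑-const (suc n) c = cong (c +_) (∑-const n c)

  ∑-↑ : (a b : ℕ) (f : Fin (a + b) → ℕ) →
        ∑[ x < a + b ] f x ≡ ∑[ i < a ] f (i ↑ˡ b) + ∑[ j < b ] f (a ↑ʳ j)
  ∑-↑ zero    b f = refl
  ∑-↑ (suc a) b f = trans (cong (f zero +_) (∑-↑ a b (f ∘ suc))) (sym (+-assoc (f zero) _ _))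

  quotient-↑ˡ : ∀ {k} n (i : Fin n) → quotient {suc k} n (i ↑ˡ k * n) ≡ zero
  quotient-↑ˡ {k} n i rewrite splitAt-↑ˡ n i (k * n) = refl

  quotient-↑ʳ : ∀ {k} n (j : Fin (k * n)) → quotient {suc k} n (n ↑ʳ j) ≡ suc (quotient n j)
  quotient-↑ʳ {k} n j rewrite splitAt-↑ʳ n (k * n) j = refl

  ∑-quotient : (k n : ℕ) (g : Fin k → ℕ) → ∑[ x < k * n ] g (quotient n x) ≡ n * ∑[ i < k ] g i
  ∑-quotient zero    n g = sym (*-zeroʳ n)
  ∑-quotient (suc k) n g = begin
    ∑[ x < n + k * n ] g (quotient n x)
      ≡⟨ ∑-↑ n (k * n) (g ∘ quotient n) ⟩
    ∑[ i < n ] g (quotient n (i ↑ˡ k * n)) + ∑[ j < k * n ] g (quotient n (n ↑ʳ j))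
      ≡⟨ cong₂ _+_ (sum-cong-≗ (cong g ∘ quotient-↑ˡ n)) (sum-cong-≗ (cong g ∘ quotient-↑ʳ n)) ⟩
    ∑[ i < n ] g zero + ∑[ j < k * n ] g (suc (quotient n j))
      ≡⟨ cong₂ _+_ (∑-const n (g zero)) (∑-quotient k n (g ∘ suc)) ⟩
    n * g zero + n * ∑[ i < k ] g (suc i)
      ≡⟨ *-distribˡ-+ n (g zero) _ ⟨
    n * ∑[ i < suc k ] g i ∎
    where open ≡-Reasoning

  ∑-allMaps-suc : (h n : ℕ) (g : Vec (Fin n) (suc h) → ℕ) →
                  ∑ (allMaps (suc h) n) g ≡ ∑[ v ∈ allMaps h n ] ∑[ x < n ] g (x ∷ v)
  ∑-allMaps-suc h n g = trans (∑-concatMap _ g (allMaps h n)) (∑-cong fibre (allMaps h n))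
    where
    fibre : ∀ v → ∑ (map (_∷ v) (allFin n)) g ≡ ∑[ x < n ] g (x ∷ v)
    fibre v = trans (∑-map (_∷ v) g (allFin n)) (∑-allFin n (g ∘ (_∷ v)))

  ∑-allMaps-quotient : (h k n : ℕ) (g : Vec (Fin k) h → ℕ) →
                       ∑[ v ∈ allMaps h (k * n) ] g (vmap (quotient n) v) ≡ n ^ h * ∑ (allMaps h k) g
  ∑-allMaps-quotient zero    k n g = sym (+-identityʳ (g [] + 0))
  ∑-allMaps-quotient (suc h) k n g = begin
    ∑[ v ∈ allMaps (suc h) (k * n) ] g (vmap q v)
      ≡⟨ ∑-allMaps-suc h (k * n) _ ⟩
    ∑[ v ∈ allMaps h (k * n) ] ∑[ x < k * n ] g (q x ∷ vmap q v)
      ≡⟨ ∑-cong (λ v → ∑-quotient k n (λ y → g (y ∷ vmap q v))) (allMaps h (k * n)) ⟩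
    ∑[ v ∈ allMaps h (k * n) ] (n * ∑[ y < k ] g (y ∷ vmap q v))
      ≡⟨ ∑-allMaps-quotient h k n (λ u → n * ∑[ y < k ] g (y ∷ u)) ⟩
    n ^ h * ∑[ u ∈ allMaps h k ] (n * ∑[ y < k ] g (y ∷ u))
      ≡⟨ cong (n ^ h *_) (∑-*ˡ n _ (allMaps h k)) ⟩
    n ^ h * (n * ∑[ u ∈ allMaps h k ] ∑[ y < k ] g (y ∷ u))
      ≡⟨ cong (λ s → n ^ h * (n * s)) (∑-allMaps-suc h k g) ⟨
    n ^ h * (n * ∑ (allMaps (suc h) k) g)
      ≡⟨ *-assoc (n ^ h) n _ ⟨
    n ^ h * n * ∑ (allMaps (suc h) k) g
      ≡⟨ cong (_* ∑ (allMaps (suc h) k) g) (*-comm (n ^ h) n) ⟩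
    n ^ suc h * ∑ (allMaps (suc h) k) g ∎
    where
    open ≡-Reasoning
    q = quotient n


module BlowUps where
  open Sums
  open import Data.Bool using (Bool; true; false; T; not; _∨_; if_then_else_)
  open import Data.Bool.ListAction using (all)
  open import Data.Bool.Properties using (T-∨)
  open import Data.Empty using (⊥-elim)
  open import Data.Fin using (Fin; toℕ; quotient; _≟_)
  open import Data.List using ([]; _∷_; length; filterᵇ; allFin)
  import Data.List.Relation.Unary.All as All
  open import Data.List.Relation.Unary.All.Properties using (all⁺; all⁻)
  open import Data.Integer using (+_)
  import Data.Integer as ℤ
  import Data.Integer.Properties as ℤ
  open import Data.Nat using (ℕ; zero; suc; _*_; _^_; _≤_; z≤n; _≡ᵇ_; ∣_-_∣; NonZero)
  open import Data.Nat.Properties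
    using (≤-refl; *-monoˡ-≤; m^n≢0; ∣-∣-comm; ∣n-n∣≡0; module ≤-Reasoning)
  open import Data.Nat.Solver using (module +-*-Solver)
  open import Data.Rational using (_/_; toℚᵘ) renaming (_≤_ to _≤ℚ_)
  import Data.Rational.Properties as ℚ
  import Data.Rational.Unnormalised as ℚᵘ
  import Data.Rational.Unnormalised.Properties as ℚᵘ
  import Data.Sum as Sum
  open import Data.Vec using (Vec; lookup) renaming (map to vmap)
  open import Data.Vec.Properties using (lookup-map)
  open import Function using (id; _∘_; Equivalence)
  open import Relation.Binary.PropositionalEquality using (_≡_; refl; trans; cong; subst₂; module ≡-Reasoning)
  open import Relation.Nullary using (yes; no)

  isHomInto : ∀ {h n} → Graph h → (Fin n → Fin n → Bool) → Vec (Fin n) h → Bool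
  isHomInto {h} H R v =
    all (λ i → all (λ j → not (adj H i j) ∨ R (lookup v i) (lookup v j)) (allFin h)) (allFin h)

  homInto : ∀ {h n} → Graph h → (Fin n → Fin n → Bool) → ℕ
  homInto {h} {n} H R = length (filterᵇ (isHomInto H R) (allMaps h n))

  all-mono : {A : Set} {p q : A → Bool} → (∀ x → T (p x) → T (q x)) →
             ∀ xs → T (all p xs) → T (all q xs)
  all-mono {p = p} {q} p⇒q xs = all⁻ q ∘ All.map (p⇒q _) ∘ all⁺ p xs

  isHomInto-map : ∀ {h n n′} (H : Graph h) {R : Fin n → Fin n → Bool} {S : Fin n′ → Fin n′ → Bool}
                  (p : Fin n → Fin n′) → (∀ x y → T (R x y) → T (S (p x) (p y))) →
                  ∀ v → T (isHomInto H R v) → T (isHomInto H S (vmap p v))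
  isHomInto-map {h} H {R} {S} p R⇒S v = all-mono (λ i → all-mono (edge i) (allFin h)) (allFin h)
    where
    edge : ∀ i j → T (not (adj H i j) ∨ R (lookup v i) (lookup v j)) →
                   T (not (adj H i j) ∨ S (lookup (vmap p v) i) (lookup (vmap p v) j))
    edge i j rewrite lookup-map i p v | lookup-map j p v =
      Equivalence.from T-∨ ∘ Sum.map₂ (R⇒S _ _) ∘ Equivalence.to T-∨

  length-filterᵇ : {A : Set} (p : A → Bool) →
                   ∀ xs → length (filterᵇ p xs) ≡ ∑[ x ∈ xs ] (if p x then 1 else 0)
  length-filterᵇ p []       = refl
  length-filterᵇ p (x ∷ xs) with p x
  ... | true  = cong suc (length-filterᵇ p xs)
  ... | false = length-filterᵇ p xs

  if-mono : ∀ {a b : Bool} → (T a → T b) → (if a then 1 else 0) ≤ (if b then 1 else 0)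
  if-mono {false}         _   = z≤n
  if-mono {true}  {true}  _   = ≤-refl
  if-mono {true}  {false} a⇒b = ⊥-elim (a⇒b _)

  homInto-quotient-≤ : ∀ {h} k n (H : Graph h)
                       {R : Fin (k * n) → Fin (k * n) → Bool} {S : Fin k → Fin k → Bool} →
                       (∀ x y → T (R x y) → T (S (quotient n x) (quotient n y))) →
                       homInto H R ≤ n ^ h * homInto H S
  homInto-quotient-≤ {h} k n H {R} {S} R⇒S = begin
    length (filterᵇ (isHomInto H R) (allMaps h (k * n)))
      ≡⟨ length-filterᵇ _ (allMaps h (k * n)) ⟩
    ∑[ v ∈ allMaps h (k * n) ] (if isHomInto H R v then 1 else 0)
      ≤⟨ ∑-mono (λ v → if-mono (isHomInto-map H {R} {S} (quotient n) R⇒S v)) (allMaps h (k * n)) ⟩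
    ∑[ v ∈ allMaps h (k * n) ] (if isHomInto H S (vmap (quotient n) v) then 1 else 0)
      ≡⟨ ∑-allMaps-quotient h k n _ ⟩
    n ^ h * ∑[ u ∈ allMaps h k ] (if isHomInto H S u then 1 else 0)
      ≡⟨ cong (n ^ h *_) (length-filterᵇ _ (allMaps h k)) ⟨
    n ^ h * length (filterᵇ (isHomInto H S) (allMaps h k)) ∎
    where
    open ≤-Reasoning

  blowUp : ∀ {k} → Graph k → (n : ℕ) → Graph (k * n)
  blowUp B n = record
    { adj        = λ x y → adj B (quotient n x) (quotient n y)
    ; adj-sym    = λ x y → adj-sym B (quotient n x) (quotient n y)
    ; adj-irrefl = λ x → adj-irrefl B (quotient n x)
    }

  loopedComplement : ∀ {k} → Graph k → Fin k → Fin k → Bool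
  loopedComplement B a b = not (adj B a b)

  complement⇒not-adj : ∀ {k} (G : Graph k) x y → T (adj (complement G) x y) → T (not (adj G x y))
  complement⇒not-adj G x y with x ≟ y
  ... | yes _ = ⊥-elim
  ... | no  _ = id

  hom-blowUp-≤ : ∀ {h k} (H : Graph h) (B : Graph k) n → hom H (blowUp B n) ≤ n ^ h * hom H B
  hom-blowUp-≤ {k = k} H B n = homInto-quotient-≤ k n H {S = adj B} (λ _ _ → id)

  hom-complement-blowUp-≤ : ∀ {h k} (H : Graph h) (B : Graph k) n →
                            hom H (complement (blowUp B n)) ≤ n ^ h * homInto H (loopedComplement B)
  hom-complement-blowUp-≤ {k = k} H B n =
    homInto-quotient-≤ k n H {S = loopedComplement B} (complement⇒not-adj (blowUp B n))

  fraction-≤ : ∀ a c d e .{{_ : NonZero d}} .{{_ : NonZero e}} → a * e ≤ c * d → + a / d ≤ℚ + c / e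
  fraction-≤ a c (suc d) (suc e) ae≤cd = ℚ.toℚᵘ-cancel-≤ (begin
    toℚᵘ (+ a / suc d) ≃⟨ ℚ.toℚᵘ-fromℚᵘ (ℚᵘ.mkℚᵘ (+ a) d) ⟩
    ℚᵘ.mkℚᵘ (+ a) d      ≤⟨ ℚᵘ.*≤* (subst₂ ℤ._≤_ (ℤ.pos-* a (suc e)) (ℤ.pos-* c (suc d))
                                                 (ℤ.+≤+ ae≤cd)) ⟩
    ℚᵘ.mkℚᵘ (+ c) e      ≃⟨ ℚ.toℚᵘ-fromℚᵘ (ℚᵘ.mkℚᵘ (+ c) e) ⟨
    toℚᵘ (+ c / suc e) ∎)
    where open ℚᵘ.≤-Reasoning

  ^-distribʳ-* : ∀ m n o → (m * n) ^ o ≡ m ^ o * n ^ o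
  ^-distribʳ-* m n zero    = refl
  ^-distribʳ-* m n (suc o) = begin
    m * n * (m * n) ^ o       ≡⟨ cong (m * n *_) (^-distribʳ-* m n o) ⟩
    m * n * (m ^ o * n ^ o)   ≡⟨ solve 4 (λ m n x y → m :* n :* (x :* y) := m :* x :* (n :* y))
                                        refl m n (m ^ o) (n ^ o) ⟩
    m * m ^ o * (n * n ^ o)   ∎
    where
    open ≡-Reasoning
    open +-*-Solver

  t-≤ : ∀ {h m} (H : Graph h) (G : Graph (suc m)) {k n c} .{{_ : NonZero (k ^ h)}} →
        suc m ≡ k * n → hom H G ≤ n ^ h * c → t H G ≤ℚ + c / k ^ h
  t-≤ {h} {m} H G {k} {n} {c} size hom≤ = fraction-≤ (hom H G) c (suc m ^ h) (k ^ h) {{m^n≢0 (suc m) h}} (begin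
    hom H G * k ^ h         ≤⟨ *-monoˡ-≤ (k ^ h) hom≤ ⟩
    n ^ h * c * k ^ h       ≡⟨ solve 3 (λ x c y → x :* c :* y := c :* (y :* x)) refl (n ^ h) c (k ^ h) ⟩
    c * (k ^ h * n ^ h)     ≡⟨ cong (c *_) (^-distribʳ-* k n h) ⟨
    c * (k * n) ^ h         ≡⟨ cong (λ v → c * v ^ h) size ⟨
    c * suc m ^ h           ∎)
    where
    open ≤-Reasoning
    open +-*-Solver

  t-blowUp-≤ : ∀ {h k} (H : Graph h) (B : Graph (suc k)) N .{{_ : NonZero (suc k ^ h)}} →
               t H (blowUp B (suc N)) ≤ℚ + hom H B / suc k ^ h
  t-blowUp-≤ H B N = t-≤ H (blowUp B (suc N)) refl (hom-blowUp-≤ H B (suc N))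

  t-complement-blowUp-≤ : ∀ {h k} (H : Graph h) (B : Graph (suc k)) N .{{_ : NonZero (suc k ^ h)}} →
                          t H (complement (blowUp B (suc N))) ≤ℚ + homInto H (loopedComplement B) / suc k ^ h
  t-complement-blowUp-≤ H B N =
    t-≤ H (complement (blowUp B (suc N))) refl (hom-complement-blowUp-≤ H B (suc N))

  distanceGraph : ∀ {k} (D : ℕ → Bool) → D 0 ≡ false → Graph k
  distanceGraph D D0≡false = record
    { adj        = λ i j → D ∣ toℕ i - toℕ j ∣
    ; adj-sym    = λ i j → cong D (∣-∣-comm (toℕ i) (toℕ j))
    ; adj-irrefl = λ i → trans (cong D (∣n-n∣≡0 (toℕ i))) D0≡false
    }

  K2 : Graph 2
  K2 = distanceGraph (_≡ᵇ 1) refl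

  C6 : Graph 6
  C6 = distanceGraph (λ d → (d ≡ᵇ 1) ∨ (d ≡ᵇ 5)) refl

  prism : Graph 6
  prism = complement C6

  hom-K3-K2 : hom K3 K2 ≡ 0
  hom-K3-K2 = refl

  homInto-C5-K2 : homInto C5 (loopedComplement K2) ≡ 2
  homInto-C5-K2 = refl

  hom-K3-prism : hom K3 prism ≡ 12
  hom-K3-prism = refl

  homInto-C5-prism : homInto C5 (loopedComplement prism) ≡ 306
  homInto-C5-prism = refl

open BlowUps

open import Data.Nat using (ℕ; suc; _≤_; _^_)
open import Data.Integer using (+_)
open import Data.Rational using (ℚ; _/_; _+_; _-_; _*_; 0ℚ) renaming (_≤_ to _≤ℚ_; _<_ to _<ℚ_)
open import Data.Product using (Σ; _×_; _,_)

open import Data.Nat.Properties using (m≤m+n)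
open import Data.Rational using (-_; NonNegative; nonNegative)
open import Data.Rational.Properties
  using (≤-trans; ≤-reflexive; ≤-total; <⇒≤; ≤ᵇ⇒≤; +-mono-≤; +-monoˡ-≤; +-monoʳ-≤;
         +-identityʳ; +-inverseʳ;
         neg-antimono-≤; *-monoˡ-≤-nonNeg; *-monoʳ-≤-nonNeg; module ≤-Reasoning)
open import Data.Rational.Solver using (module +-*-Solver)
open import Data.Sum using ([_,_]′)
open import Relation.Binary.PropositionalEquality using (_≡_; refl; sym; cong₂)

p≤q⇒0≤q-p : ∀ {p q} → p ≤ℚ q → 0ℚ ≤ℚ q - p
p≤q⇒0≤q-p {p} {q} p≤q = ≤-trans (≤-reflexive (sym (+-inverseʳ p))) (+-monoˡ-≤ (- p) p≤q)

-- The combination λ′ x + (2 - λ′) y is written out rather than named: unfolding a name when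
-- matching the theorem makes Agda normalise densities of blow-ups, which is prohibitively slow.
mix-mono-≤ : ∀ {λ′ x x′ y y′} → 0ℚ ≤ℚ λ′ → λ′ ≤ℚ + 2 / 1 → x ≤ℚ x′ → y ≤ℚ y′ →
             λ′ * x + (+ 2 / 1 - λ′) * y ≤ℚ λ′ * x′ + (+ 2 / 1 - λ′) * y′
mix-mono-≤ {λ′} 0≤λ′ λ′≤2 x≤x′ y≤y′ =
  +-mono-≤ (*-monoˡ-≤-nonNeg λ′ {{nonNegative 0≤λ′}} x≤x′)
           (*-monoˡ-≤-nonNeg (+ 2 / 1 - λ′) {{nonNegative (p≤q⇒0≤q-p λ′≤2)}} y≤y′)

mix-monoˡ-≤ : ∀ {λ′ μ x y} → y ≤ℚ x → λ′ ≤ℚ μ →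
              λ′ * x + (+ 2 / 1 - λ′) * y ≤ℚ μ * x + (+ 2 / 1 - μ) * y
mix-monoˡ-≤ {λ′} {μ} {x} {y} y≤x λ′≤μ = begin
  λ′ * x + (+ 2 / 1 - λ′) * y    ≡⟨ affine λ′ ⟩
  + 2 / 1 * y + λ′ * (x - y)     ≤⟨ +-monoʳ-≤ (+ 2 / 1 * y) (*-monoʳ-≤-nonNeg (x - y) {{0≤x-y}} λ′≤μ) ⟩
  + 2 / 1 * y + μ * (x - y)      ≡⟨ affine μ ⟨
  μ * x + (+ 2 / 1 - μ) * y      ∎
  where
  open ≤-Reasoning
  affine : ∀ ν → ν * x + (+ 2 / 1 - ν) * y ≡ + 2 / 1 * y + ν * (x - y)
  affine ν = solve 3 (λ ν x y → let ② = con (+ 2 / 1) in ν :* x :+ (② :- ν) :* y := ② :* y :+ ν :* (x :- y))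
                     refl ν x y
    where open +-*-Solver
  0≤x-y : NonNegative (x - y)
  0≤x-y = nonNegative (p≤q⇒0≤q-p y≤x)

mix-antimonoˡ-≤ : ∀ {λ′ μ x y} → x ≤ℚ y → μ ≤ℚ λ′ →
                  λ′ * x + (+ 2 / 1 - λ′) * y ≤ℚ μ * x + (+ 2 / 1 - μ) * y
mix-antimonoˡ-≤ {λ′} {μ} {x} {y} x≤y μ≤λ′ = begin
  λ′ * x + (+ 2 / 1 - λ′) * y                          ≡⟨ swap λ′ ⟩
  (+ 2 / 1 - λ′) * y + (+ 2 / 1 - (+ 2 / 1 - λ′)) * x
    ≤⟨ mix-monoˡ-≤ x≤y (+-monoʳ-≤ (+ 2 / 1) (neg-antimono-≤ μ≤λ′)) ⟩
  (+ 2 / 1 - μ) * y + (+ 2 / 1 - (+ 2 / 1 - μ)) * x    ≡⟨ swap μ ⟨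
  μ * x + (+ 2 / 1 - μ) * y                            ∎
  where
  open ≤-Reasoning
  swap : ∀ ν → ν * x + (+ 2 / 1 - ν) * y ≡ (+ 2 / 1 - ν) * y + (+ 2 / 1 - (+ 2 / 1 - ν)) * x
  swap ν = solve 3 (λ ν x y → let ② = con (+ 2 / 1) in ν :* x :+ (② :- ν) :* y := (② :- ν) :* y :+ (② :- (② :- ν)) :* x)
                   refl ν x y
    where open +-*-Solver

λ₀ : ℚ
λ₀ = + 10 / 17

mix-blowUp-prism-≤ : ∀ N {λ′} → 0ℚ ≤ℚ λ′ → λ′ ≤ℚ + 2 / 1 → λ′ ≤ℚ λ₀ →
                     λ′ * t K3 (blowUp prism (suc N)) + (+ 2 / 1 - λ′) * t C5 (complement (blowUp prism (suc N)))
                       ≤ℚ + 3 / 34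
mix-blowUp-prism-≤ N {λ′} 0≤λ′ λ′≤2 λ′≤λ₀ = begin
  λ′ * t K3 (blowUp prism (suc N)) + (+ 2 / 1 - λ′) * t C5 (complement (blowUp prism (suc N)))
    ≤⟨ mix-mono-≤ 0≤λ′ λ′≤2 (t-blowUp-≤ K3 prism N) (t-complement-blowUp-≤ C5 prism N) ⟩
  λ′ * (+ hom K3 prism / 6 ^ 3) + (+ 2 / 1 - λ′) * (+ homInto C5 (loopedComplement prism) / 6 ^ 5)
    ≡⟨ cong₂ (λ a b → λ′ * (+ a / 6 ^ 3) + (+ 2 / 1 - λ′) * (+ b / 6 ^ 5))
             hom-K3-prism homInto-C5-prism ⟩
  λ′ * (+ 12 / 6 ^ 3) + (+ 2 / 1 - λ′) * (+ 306 / 6 ^ 5)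
    ≤⟨ mix-monoˡ-≤ (≤ᵇ⇒≤ _) λ′≤λ₀ ⟩
  λ₀ * (+ 12 / 6 ^ 3) + (+ 2 / 1 - λ₀) * (+ 306 / 6 ^ 5)
    ≤⟨ ≤ᵇ⇒≤ _ ⟩
  + 3 / 34 ∎
  where open ≤-Reasoning

mix-blowUp-K2-≤ : ∀ N {λ′} → 0ℚ ≤ℚ λ′ → λ′ ≤ℚ + 2 / 1 → λ₀ ≤ℚ λ′ →
                  λ′ * t K3 (blowUp K2 (suc N)) + (+ 2 / 1 - λ′) * t C5 (complement (blowUp K2 (suc N)))
                    ≤ℚ + 3 / 34
mix-blowUp-K2-≤ N {λ′} 0≤λ′ λ′≤2 λ₀≤λ′ = begin
  λ′ * t K3 (blowUp K2 (suc N)) + (+ 2 / 1 - λ′) * t C5 (complement (blowUp K2 (suc N)))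
    ≤⟨ mix-mono-≤ 0≤λ′ λ′≤2 (t-blowUp-≤ K3 K2 N) (t-complement-blowUp-≤ C5 K2 N) ⟩
  λ′ * (+ hom K3 K2 / 2 ^ 3) + (+ 2 / 1 - λ′) * (+ homInto C5 (loopedComplement K2) / 2 ^ 5)
    ≡⟨ cong₂ (λ a b → λ′ * (+ a / 2 ^ 3) + (+ 2 / 1 - λ′) * (+ b / 2 ^ 5)) hom-K3-K2 homInto-C5-K2 ⟩
  λ′ * (+ 0 / 2 ^ 3) + (+ 2 / 1 - λ′) * (+ 2 / 2 ^ 5)
    ≤⟨ mix-antimonoˡ-≤ (≤ᵇ⇒≤ _) λ₀≤λ′ ⟩
  λ₀ * (+ 0 / 2 ^ 3) + (+ 2 / 1 - λ₀) * (+ 2 / 2 ^ 5)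
    ≤⟨ ≤ᵇ⇒≤ _ ⟩
  + 3 / 34 ∎
  where open ≤-Reasoning

p≤q⇒p≤q+r : ∀ {p q r} → p ≤ℚ q → 0ℚ ≤ℚ r → p ≤ℚ q + r
p≤q⇒p≤q+r {p} {q} p≤q 0≤r = ≤-trans p≤q (≤-trans (≤-reflexive (sym (+-identityʳ q))) (+-monoʳ-≤ q 0≤r))

proposition4p5 : (λ′ : ℚ) → 0ℚ ≤ℚ λ′ → λ′ ≤ℚ (+ 2 / 1) → (ε : ℚ) → 0ℚ <ℚ ε → (N : ℕ) →
    Σ ℕ (λ m → N ≤ m × Σ (Graph (suc m)) (λ G →
      (λ′ * t K3 G + ((+ 2 / 1) - λ′) * t C5 (complement G)) ≤ℚ ((+ 3 / 34) + ε)))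
proposition4p5 λ′ 0≤λ′ λ′≤2 ε 0<ε N =
  [ (λ λ′≤λ₀ → _ , m≤m+n N _ , blowUp prism (suc N) ,
                p≤q⇒p≤q+r (mix-blowUp-prism-≤ N 0≤λ′ λ′≤2 λ′≤λ₀) (<⇒≤ 0<ε))
  , (λ λ₀≤λ′ → _ , m≤m+n N _ , blowUp K2 (suc N) ,
                p≤q⇒p≤q+r (mix-blowUp-K2-≤ N 0≤λ′ λ′≤2 λ₀≤λ′) (<⇒≤ 0<ε))
  ]′ (≤-total λ′ λ₀)
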